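{- For every integer $m\geq 3$, $\lambda_1^1(P_m \times C_6)=5$.
   Context: For a graph $G$, an $L(1,1)$-labeling with labels in $\{0,1,\dots,p\}$ is a function $l:V(G)\to\{0,1,\dots,p\}$ such that $l(u)\neq l(v)$ whenever the distance $d(u,v)$ is $1$ or $2$. $\lambda_1^1(G)$ denotes the least $p$ for which $G$ admits such a labeling. $P_m$ denotes the path with $m$ vertices and $C_n$ the cycle with $n$ vertices. The direct product $G\times H$ has vertex set $V(G)\times V(H)$, with $(x_1,x_2)$ adjacent to $(y_1,y_2)$ iff $x_1y_1\in E(G)$ and $x_2y_2\in E(H)$. -}

module Defs where

open import Data.Nat using (ℕ; zero; suc; _+_; _<_; _%_)
open import Data.Fin using (Fin; toℕ)
open import Data.Product using (_×_; _,_; ∃; ∃-syntax)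
open import Data.Sum using (_⊎_)
open import Relation.Binary.PropositionalEquality using (_≡_; _≢_)
open import Relation.Nullary using (¬_)

record Graph : Set₁ where
  field
    V   : Set
    Adj : V → V → Set
open Graph public

PathAdj : (m : ℕ) → Fin m → Fin m → Set
PathAdj m i j = (suc (toℕ i) ≡ toℕ j) ⊎ (suc (toℕ j) ≡ toℕ i)

P : ℕ → Graph
P m = record { V = Fin m ; Adj = PathAdj m }

CycleAdj : (n : ℕ) → Fin n → Fin n → Set
CycleAdj zero    i j = (suc (toℕ i) ≡ toℕ j) ⊎ (suc (toℕ j) ≡ toℕ i)
CycleAdj (suc n) i j = ((suc (toℕ i)) % suc n ≡ toℕ j) ⊎ ((suc (toℕ j)) % suc n ≡ toℕ i)

C : ℕ → Graph
C n = record { V = Fin n ; Adj = CycleAdj n }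

_⊗_ : Graph → Graph → Graph
G ⊗ H = record
  { V   = V G × V H
  ; Adj = λ { (x₁ , x₂) (y₁ , y₂) → Adj G x₁ y₁ × Adj H x₂ y₂ } }

Dist≤2 : (G : Graph) → V G → V G → Set
Dist≤2 G u v = Adj G u v ⊎ (u ≢ v × ∃[ w ] (Adj G u w × Adj G w v))

IsL11Labeling : (G : Graph) (p : ℕ) → (V G → Fin (suc p)) → Set
IsL11Labeling G p l = ∀ u v → Dist≤2 G u v → l u ≢ l v

HasL11Labeling : Graph → ℕ → Set
HasL11Labeling G p = ∃[ l ] IsL11Labeling G p l

λ11≡ : Graph → ℕ → Set
λ11≡ G p = HasL11Labeling G p × (∀ q → q < p → ¬ HasL11Labeling G q)

-- Upper bound: folding the path around C₄ is a graph homomorphism that never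
-- identifies two vertices with a common neighbour, so P_m × C₆ → C₄ × C₆ pulls
-- back L(1,1)-labelings, and C₄ × C₆ (24 vertices) has one with labels 0,…,5.
-- Lower bound: the six vertices {0,2} × {1,3,5} pairwise share a neighbour,
-- so they need six distinct labels.
module Submission where

open import Defs
open import Data.Nat as ℕ using (ℕ; zero; suc; _+_; _*_; _%_; _<_; _≥_; s≤s; z≤n)
open import Data.Nat.DivMod using (_mod_)
open import Data.Fin using (Fin; toℕ; quotient; remainder; combine)
open import Data.Fin.Patterns using (0F; 1F; 2F; 3F; 4F; 5F)
open import Data.Fin.Properties
  using (toℕ-fromℕ<; toℕ-injective; combine-remQuot; pigeonhole; all?; any?; <⇒≢; _≟_)
open import Data.Product using (_×_; _,_; ∃-syntax; map; uncurry)
open import Data.Product.Properties using (,-injective; ×-≡,≡→≡; ≡-dec)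
open import Data.Sum using (_⊎_; inj₁; inj₂; swap)
open import Data.Unit using (tt)
open import Data.Empty using (⊥-elim)
open import Data.Vec using (Vec; []; _∷_; lookup)
open import Function using (_∘_; id; Injective)
open import Relation.Binary.PropositionalEquality
  using (_≡_; _≢_; refl; sym; trans; cong; cong₂; subst)
open import Relation.Nullary using (Dec; ¬_)
open import Relation.Nullary.Decidable
  using (_⊎-dec_; _×-dec_; _→-dec_; ¬?; map′; toWitness)

Homomorphism : (G H : Graph) → (V G → V H) → Set
Homomorphism G H f = ∀ {u v} → Adj G u v → Adj H (f u) (f v)

CommonNeighbour : (G : Graph) → V G → V G → Set
CommonNeighbour G u v = ∃[ w ] (Adj G u w × Adj G w v)

TwoStepInjective : (G : Graph) {A : Set} → (V G → A) → Set
TwoStepInjective G f = ∀ {u v} → CommonNeighbour G u v → f u ≡ f v → u ≡ v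

module _ {G G′ H H′ : Graph} {f : V G → V G′} {g : V H → V H′} where

  homomorphism-⊗ : Homomorphism G G′ f → Homomorphism H H′ g →
                   Homomorphism (G ⊗ H) (G′ ⊗ H′) (map f g)
  homomorphism-⊗ f-hom g-hom (adj₁ , adj₂) = f-hom adj₁ , g-hom adj₂

  twoStepInjective-⊗ : TwoStepInjective G f → TwoStepInjective H g →
                       TwoStepInjective (G ⊗ H) (map f g)
  twoStepInjective-⊗ f-inj g-inj ((w₁ , w₂) , (a₁ , a₂) , (b₁ , b₂)) eq =
    let eq₁ , eq₂ = ,-injective eq
    in  cong₂ _,_ (f-inj (w₁ , a₁ , b₁) eq₁) (g-inj (w₂ , a₂ , b₂) eq₂)

commonNeighbour-⊗ : ∀ {G H u₁ v₁ u₂ v₂} →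
                    CommonNeighbour G u₁ v₁ → CommonNeighbour H u₂ v₂ →
                    CommonNeighbour (G ⊗ H) (u₁ , u₂) (v₁ , v₂)
commonNeighbour-⊗ (w₁ , a₁ , b₁) (w₂ , a₂ , b₂) = (w₁ , w₂) , (a₁ , a₂) , (b₁ , b₂)

module _ {G : Graph} {p : ℕ} {l : V G → Fin (suc p)} where

  isL11-fromTwoStepInjective : (∀ {u v} → Adj G u v → l u ≢ l v) →
                               TwoStepInjective G l → IsL11Labeling G p l
  isL11-fromTwoStepInjective adj-distinct l-inj u v (inj₁ adj) = adj-distinct adj
  isL11-fromTwoStepInjective adj-distinct l-inj u v (inj₂ (u≢v , common)) =
    u≢v ∘ l-inj common

module _ {G H : Graph} {f : V G → V H} where

  isL11-pullback : ∀ {p} {l : V H → Fin (suc p)} →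
                   Homomorphism G H f → TwoStepInjective G f →
                   IsL11Labeling H p l → IsL11Labeling G p (l ∘ f)
  isL11-pullback f-hom f-inj l-isL11 u v (inj₁ adj) =
    l-isL11 (f u) (f v) (inj₁ (f-hom adj))
  isL11-pullback f-hom f-inj l-isL11 u v (inj₂ (u≢v , w , a , b)) =
    l-isL11 (f u) (f v) (inj₂ (u≢v ∘ f-inj (w , a , b) , f w , f-hom a , f-hom b))

-- The diagonal is included in `common` so that the family is closed under ⊗;
-- distinct members are then at distance at most two.
record SquareClique (G : Graph) (n : ℕ) : Set where
  field
    point           : Fin n → V G
    point-injective : Injective _≡_ _≡_ point
    common          : ∀ x y → CommonNeighbour G (point x) (point y)

open SquareClique

squareClique-⊗ : ∀ {G H a b} → SquareClique G a → SquareClique H b →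
                 SquareClique (G ⊗ H) (a * b)
squareClique-⊗ {G} {H} {a} {b} K L = record
  { point           = λ x → point K (quotient {a} b x) , point L (remainder {a} b x)
  ; point-injective = injective
  ; common          = λ x y → commonNeighbour-⊗ {G} {H} (common K _ _) (common L _ _)
  }
  where
  injective : ∀ {x y} → (point K (quotient {a} b x) , point L (remainder {a} b x))
                      ≡ (point K (quotient {a} b y) , point L (remainder {a} b y)) → x ≡ y
  injective {x} {y} eq =
    let eq₁ , eq₂ = ,-injective eq
        remQuot≡  = ×-≡,≡→≡ (point-injective K eq₁ , point-injective L eq₂)
    in  trans (sym (combine-remQuot {a} b x))
              (trans (cong (uncurry combine) remQuot≡) (combine-remQuot {a} b y))

squareClique⇒¬L11 : ∀ {G n q} → SquareClique G n → suc q < n → ¬ HasL11Labeling G q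
squareClique⇒¬L11 K q<n (l , l-isL11) with pigeonhole q<n (l ∘ point K)
... | x , y , x<y , eq =
  l-isL11 _ _ (inj₂ (<⇒≢ x<y ∘ point-injective K , common K x y)) eq

sucMod : ∀ {n} → Fin (suc n) → Fin (suc n)
sucMod {n} a = suc (toℕ a) mod suc n

cycleAdj-sucMod : ∀ {n} (a : Fin (suc n)) → CycleAdj (suc n) a (sucMod a)
cycleAdj-sucMod a = inj₁ (sym (toℕ-fromℕ< _))

cycleAdj? : ∀ {n} (a b : Fin (suc n)) → Dec (CycleAdj (suc n) a b)
cycleAdj? {n} a b =
  (suc (toℕ a) % suc n ℕ.≟ toℕ b) ⊎-dec (suc (toℕ b) % suc n ℕ.≟ toℕ a)

wind : ∀ {n} → ℕ → Fin (suc n)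
wind zero    = 0F
wind (suc x) = sucMod (wind x)

wind-homomorphism : ∀ {m n} → Homomorphism (P m) (C (suc n)) (wind ∘ toℕ)
wind-homomorphism (inj₁ e) = subst (CycleAdj _ _ ∘ wind) e (cycleAdj-sucMod _)
wind-homomorphism (inj₂ e) = swap (subst (CycleAdj _ _ ∘ wind) e (cycleAdj-sucMod _))

wind-twoStepInjective : ∀ {m} → TwoStepInjective (P m) (wind {3} ∘ toℕ)
wind-twoStepInjective (_ , a , b) eq = toℕ-injective (twoSteps a b eq)
  where
  sucMod²≢id : ∀ (a : Fin 4) → sucMod (sucMod a) ≢ a
  sucMod²≢id 0F ()
  sucMod²≢id 1F ()
  sucMod²≢id 2F ()
  sucMod²≢id 3F ()

  twoSteps : ∀ {x y z} → (suc x ≡ y ⊎ suc y ≡ x) → (suc y ≡ z ⊎ suc z ≡ y) →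
             wind x ≡ wind z → x ≡ z
  twoSteps (inj₁ refl) (inj₁ refl) eq = ⊥-elim (sucMod²≢id _ (sym eq))
  twoSteps (inj₁ refl) (inj₂ refl) _  = refl
  twoSteps (inj₂ refl) (inj₁ refl) _  = refl
  twoSteps (inj₂ refl) (inj₂ refl) eq = ⊥-elim (sucMod²≢id _ eq)

-- Row a is the labeling of the rows i ≡ a (mod 4) of P_m × C₆.
table : V (C 4 ⊗ C 6) → Fin 6
table (a , j) = lookup (lookup rows a) j
  where
  rows : Vec (Vec (Fin 6) 6) 4
  rows = (0F ∷ 0F ∷ 1F ∷ 1F ∷ 2F ∷ 2F ∷ [])
       ∷ (1F ∷ 2F ∷ 2F ∷ 0F ∷ 0F ∷ 1F ∷ [])
       ∷ (3F ∷ 3F ∷ 4F ∷ 4F ∷ 5F ∷ 5F ∷ [])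
       ∷ (4F ∷ 5F ∷ 5F ∷ 3F ∷ 3F ∷ 4F ∷ [])
       ∷ []

table-isL11 : IsL11Labeling (C 4 ⊗ C 6) 5 table
table-isL11 = isL11-fromTwoStepInjective adjacent-distinct twoStepInjective
  where
  all×? : ∀ {a b} {Q : Fin a × Fin b → Set} → (∀ x → Dec (Q x)) → Dec (∀ x → Q x)
  all×? Q? = map′ (λ h (i , j) → h i j) (λ h i j → h (i , j))
                  (all? λ i → all? λ j → Q? (i , j))

  adj? : ∀ u v → Dec (Adj (C 4 ⊗ C 6) u v)
  adj? (a , j) (b , k) = cycleAdj? a b ×-dec cycleAdj? j k

  adjacent-distinct : ∀ {u v} → Adj (C 4 ⊗ C 6) u v → table u ≢ table v
  adjacent-distinct {u} {v} = toWitness {a? = all×? λ u → all×? λ v →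
    adj? u v →-dec ¬? (table u ≟ table v)} tt u v

  twoStepInjective : TwoStepInjective (C 4 ⊗ C 6) table
  twoStepInjective {u} {v} (w , a , b) = toWitness {a? = all×? λ u → all×? λ w → all×? λ v →
    adj? u w →-dec (adj? w v →-dec (table u ≟ table v →-dec ≡-dec _≟_ _≟_ u v))} tt u w v a b

evenRows : ∀ k → SquareClique (P (3 + k)) 2
evenRows k = record
  { point           = row
  ; point-injective = injective
  ; common          = λ x y → 1F , down x , up y
  }
  where
  row : Fin 2 → Fin (3 + k)
  row 0F = 0F
  row 1F = 2F

  injective : Injective _≡_ _≡_ row
  injective {0F} {0F} _ = refl
  injective {0F} {1F} ()
  injective {1F} {0F} ()
  injective {1F} {1F} _ = refl

  down : ∀ x → PathAdj (3 + k) (row x) 1F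
  down 0F = inj₁ refl
  down 1F = inj₂ refl

  up : ∀ x → PathAdj (3 + k) 1F (row x)
  up x = swap (down x)

oddColumns : SquareClique (C 6) 3
oddColumns = record
  { point           = column
  ; point-injective = injective
  ; common          = toWitness {a? = all? λ x → all? λ y →
                        any? λ w → cycleAdj? (column x) w ×-dec cycleAdj? w (column y)} tt
  }
  where
  column : Fin 3 → Fin 6
  column 0F = 1F
  column 1F = 3F
  column 2F = 5F

  injective : Injective _≡_ _≡_ column
  injective {x} {y} =
    toWitness {a? = all? λ x → all? λ y → column x ≟ column y →-dec x ≟ y} tt x y

P×C₆-hasL11 : ∀ m → HasL11Labeling (P m ⊗ C 6) 5
P×C₆-hasL11 m = table ∘ fold , isL11-pullback fold-homomorphism fold-twoStepInjective table-isL11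
  where
  fold : V (P m ⊗ C 6) → V (C 4 ⊗ C 6)
  fold = map (wind ∘ toℕ) id

  fold-homomorphism : Homomorphism (P m ⊗ C 6) (C 4 ⊗ C 6) fold
  fold-homomorphism = homomorphism-⊗ {P m} {C 4} {C 6} {C 6} wind-homomorphism id

  fold-twoStepInjective : TwoStepInjective (P m ⊗ C 6) fold
  fold-twoStepInjective =
    twoStepInjective-⊗ {P m} {C 4} {C 6} {C 6} wind-twoStepInjective (λ _ → id)

P×C₆-¬L11 : ∀ k q → q < 5 → ¬ HasL11Labeling (P (3 + k) ⊗ C 6) q
P×C₆-¬L11 k q q<5 = squareClique⇒¬L11 (squareClique-⊗ (evenRows k) oddColumns) (s≤s q<5)

mainTheorem9 : ∀ (m : ℕ) → m ≥ 3 → λ11≡ (P m ⊗ C 6) 5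
mainTheorem9 (suc (suc (suc k))) (s≤s (s≤s (s≤s z≤n))) = P×C₆-hasL11 _ , P×C₆-¬L11 k
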